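{- For each integer $n$ with $2\leq n\leq 10^4$ there exist an integer $k\geq 2$ and positive integers $a_1<a_2<\cdots<a_k$ with $a_1=n+1$ and $a_i\geq n+i$ for $i=2,\ldots,k$ such that $$\frac{n}{2^{n}}=\sum_{i=1}^{k}\frac{a_{i}}{2^{a_{i}}}.$$ -}

module Defs where

open import Data.Nat using (ℕ; zero; suc; _^_)
open import Data.Nat.Properties using (m^n≢0)
open import Data.Fin using (Fin; zero; suc)
open import Data.Integer using (+_)
open import Data.Rational using (ℚ; _/_; _+_; 0ℚ)

term : ℕ → ℚ
term a = (+ a) / (2 ^ a)
  where instance _ = m^n≢0 2 a

sumℚ : (k : ℕ) → (Fin k → ℚ) → ℚ
sumℚ zero    f = 0ℚ
sumℚ (suc k) f = f zero + sumℚ k (λ i → f (suc i))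

{-# OPTIONS --safe #-}
module Submission where

-- Expand m/2^a position by position: if m = a the sum is the single term a/2^a;
-- if m < a skip position a, since m/2^a = 2m/2^(a+1); if m > a take the term a/2^a
-- and continue with 2(m-a)/2^(a+1). As n/2^n = (n+1)/2^(n+1) + 2(n-1)/2^(n+2), the
-- theorem follows once the expansion of 2(n-1)/2^(n+2) terminates for each n ≤ 10^4.
-- These 9999 processes are run simultaneously, processes that reach a common state
-- being merged, and all of them have terminated before position 460604.

open import Data.Bool using (Bool; true; false; _∧_; if_then_else_)
open import Data.Bool.Properties using (T-≡)
open import Data.Empty using (⊥-elim)
open import Data.Fin using (Fin; zero; suc; toℕ) renaming (_<_ to _<ᶠ_)
open import Data.Integer using (+_)
import Data.Integer as ℤ
import Data.Integer.Properties as ℤ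
import Data.Integer.Tactic.RingSolver as ℤ-Solver
open import Data.List using (List; []; _∷_; null; length; lookup)
open import Data.List.Membership.Propositional using (_∈_)
open import Data.List.Relation.Unary.Any using (here; there)
open import Data.Nat using (ℕ; zero; suc; _+_; _*_; _∸_; _^_; _≤_; _<_; _<ᵇ_; _≤ᵇ_; z≤n; s≤s; NonZero)
open import Data.Nat.Properties
  using (≤-refl; ≤-trans; <⇒≤; <-irrefl; <-≤-trans; n≤1+n; m≤m+n; m≤n⇒m<n∨m≡n; <-cmp;
         +-identityʳ; +-suc; +-comm; +-monoˡ-≤; m+[n∸m]≡n; m^n≢0; <ᵇ⇒<; <⇒<ᵇ; ≤⇒≤ᵇ)
import Data.Nat.Tactic.RingSolver as ℕ-Solver
open import Data.Product using (Σ; _×_; _,_; proj₁; proj₂)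
open import Data.Rational using (fromℚᵘ; toℚᵘ; _/_) renaming (_+_ to _+ℚ_)
import Data.Rational.Properties as ℚ
open import Data.Rational.Unnormalised using (ℚᵘ; 0ℚᵘ; *≡*; _≃_) renaming (_/_ to _/ᵘ_; _+_ to _+ᵘ_)
open import Data.Rational.Unnormalised.Properties
  using (≃-sym; ≃-trans; ≃-reflexive; *-cancelˡ-/; module ≃-Reasoning)
  renaming (+-cong to +ᵘ-cong; +-congʳ to +ᵘ-congʳ; +-identityʳ to +ᵘ-identityʳ)
open import Data.Sum using (inj₁; inj₂)
open import Data.Unit using (⊤; tt)
open import Function.Bundles using (Equivalence)
open import Relation.Binary.Definitions using (tri<; tri≈; tri>)
open import Relation.Binary.PropositionalEquality
  using (_≡_; refl; sym; trans; cong; cong₂; subst; module ≡-Reasoning)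

open import Defs

/-fromℚᵘ : ∀ i d .{{_ : NonZero d}} → i / d ≡ fromℚᵘ (i /ᵘ d)
/-fromℚᵘ i (suc d) = refl

fromℚᵘ-homo-+ : ∀ p q → fromℚᵘ (p +ᵘ q) ≡ fromℚᵘ p +ℚ fromℚᵘ q
fromℚᵘ-homo-+ p q = ℚ.toℚᵘ-injective (begin
  toℚᵘ (fromℚᵘ (p +ᵘ q))                ≈⟨ ℚ.toℚᵘ-fromℚᵘ (p +ᵘ q) ⟩
  p +ᵘ q                                 ≈⟨ +ᵘ-cong (≃-sym (ℚ.toℚᵘ-fromℚᵘ p)) (≃-sym (ℚ.toℚᵘ-fromℚᵘ q)) ⟩
  toℚᵘ (fromℚᵘ p) +ᵘ toℚᵘ (fromℚᵘ q)    ≈⟨ ≃-sym (ℚ.toℚᵘ-homo-+ (fromℚᵘ p) (fromℚᵘ q)) ⟩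
  toℚᵘ (fromℚᵘ p +ℚ fromℚᵘ q)           ∎)
  where open ≃-Reasoning

/ᵘ-+ : ∀ i j d .{{_ : NonZero d}} → (i /ᵘ d) +ᵘ (j /ᵘ d) ≃ (i ℤ.+ j) /ᵘ d
/ᵘ-+ i j d@(suc _) = *≡* (begin
  (i ℤ.* + d ℤ.+ j ℤ.* + d) ℤ.* + d  ≡⟨ distrib i j (+ d) ⟩
  (i ℤ.+ j) ℤ.* (+ d ℤ.* + d)        ≡⟨ cong ((i ℤ.+ j) ℤ.*_) (ℤ.pos-* d d) ⟨
  (i ℤ.+ j) ℤ.* + (d * d)            ∎)
  where
  open ≡-Reasoning
  distrib : ∀ i j e → (i ℤ.* e ℤ.+ j ℤ.* e) ℤ.* e ≡ (i ℤ.+ j) ℤ.* (e ℤ.* e)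
  distrib = ℤ-Solver.solve-∀

infix 5 _/2^_

_/2^_ : ℕ → ℕ → ℚᵘ
m /2^ a = (+ m /ᵘ 2 ^ a) {{m^n≢0 2 a}}

termᵘ : ℕ → ℚᵘ
termᵘ a = a /2^ a

term≡fromℚᵘ : ∀ a → term a ≡ fromℚᵘ (termᵘ a)
term≡fromℚᵘ a = /-fromℚᵘ (+ a) (2 ^ a) {{m^n≢0 2 a}}

/2^-+ : ∀ a m r → (m /2^ a) +ᵘ (r /2^ a) ≃ m + r /2^ a
/2^-+ a m r = /ᵘ-+ (+ m) (+ r) (2 ^ a) {{m^n≢0 2 a}}

/2^-double : ∀ a m → 2 * m /2^ suc a ≃ m /2^ a
/2^-double a m = ≃-trans
  (≃-reflexive (cong (λ i → (i /ᵘ 2 ^ suc a) {{m^n≢0 2 (suc a)}}) (ℤ.pos-* 2 m)))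
  (*-cancelˡ-/ 2 {+ m} {2 ^ a} {{m^n≢0 2 a}} {{m^n≢0 2 (suc a)}})

termᵘ-+-/2^ : ∀ a r → termᵘ a +ᵘ (2 * r /2^ suc a) ≃ a + r /2^ a
termᵘ-+-/2^ a r = ≃-trans (+ᵘ-congʳ (termᵘ a) (/2^-double a r)) (/2^-+ a a r)

sumᵘ : List ℕ → ℚᵘ
sumᵘ []       = 0ℚᵘ
sumᵘ (a ∷ as) = termᵘ a +ᵘ sumᵘ as

IncreasingFrom : ℕ → List ℕ → Set
IncreasingFrom b []       = ⊤
IncreasingFrom b (a ∷ as) = b ≤ a × IncreasingFrom (suc a) as

record Expansion (a m : ℕ) : Set where
  constructor expansion
  field
    first      : ℕ
    rest       : List ℕ
    increasing : IncreasingFrom a (first ∷ rest)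
    sum≃       : sumᵘ (first ∷ rest) ≃ m /2^ a

expand-self : ∀ a → Expansion a a
expand-self a = expansion a [] (≤-refl , tt) (+ᵘ-identityʳ (termᵘ a))

expand-skip : ∀ {a m} → Expansion (suc a) (2 * m) → Expansion a m
expand-skip {a} {m} (expansion x xs (a<x , inc) s) =
  expansion x xs (≤-trans (n≤1+n a) a<x , inc) (≃-trans s (/2^-double a m))

expand-take : ∀ {a r} → Expansion (suc a) (2 * r) → Expansion a (a + r)
expand-take {a} {r} (expansion x xs inc s) =
  expansion a (x ∷ xs) (≤-refl , inc) (≃-trans (+ᵘ-congʳ (termᵘ a) s) (termᵘ-+-/2^ a r))

union : List ℕ → List ℕ → List ℕ
union []       ys       = ys
union (x ∷ xs) []       = x ∷ xs
union (x ∷ xs) (y ∷ ys) =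
  if x <ᵇ y then x ∷ union xs (y ∷ ys)
  else if y <ᵇ x then y ∷ union (x ∷ xs) ys
  else x ∷ union xs ys

≮ᵇ-antisym : ∀ x y → (x <ᵇ y) ≡ false → (y <ᵇ x) ≡ false → x ≡ y
≮ᵇ-antisym zero    zero    _ _ = refl
≮ᵇ-antisym (suc x) (suc y) p q = cong suc (≮ᵇ-antisym x y p q)

∈-union⁺ˡ : ∀ {z} xs ys → z ∈ xs → z ∈ union xs ys
∈-union⁺ˡ (x ∷ xs) []       z∈xs = z∈xs
∈-union⁺ˡ (x ∷ xs) (y ∷ ys) z∈xs with x <ᵇ y | y <ᵇ x | z∈xs
... | true  | _     | here z≡x    = here z≡x
... | true  | _     | there z∈xs′ = there (∈-union⁺ˡ xs (y ∷ ys) z∈xs′)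
... | false | true  | _           = there (∈-union⁺ˡ (x ∷ xs) ys z∈xs)
... | false | false | here z≡x    = here z≡x
... | false | false | there z∈xs′ = there (∈-union⁺ˡ xs ys z∈xs′)

∈-union⁺ʳ : ∀ {z} xs ys → z ∈ ys → z ∈ union xs ys
∈-union⁺ʳ []       ys       z∈ys = z∈ys
∈-union⁺ʳ (x ∷ xs) (y ∷ ys) z∈ys with x <ᵇ y in x≮y | y <ᵇ x in y≮x | z∈ys
... | true  | _     | _           = there (∈-union⁺ʳ xs (y ∷ ys) z∈ys)
... | false | true  | here z≡y    = here z≡y
... | false | true  | there z∈ys′ = there (∈-union⁺ʳ (x ∷ xs) ys z∈ys′)
... | false | false | here z≡y    = here (trans z≡y (sym (≮ᵇ-antisym x y x≮y y≮x)))
... | false | false | there z∈ys′ = there (∈-union⁺ʳ xs ys z∈ys′)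

doubledBelow : ℕ → List ℕ → List ℕ
doubledBelow a []       = []
doubledBelow a (m ∷ ms) =
  if m <ᵇ a then 2 * m ∷ doubledBelow a ms else doubledBelow a ms

doubledExcess : ℕ → List ℕ → List ℕ
doubledExcess a []       = []
doubledExcess a (m ∷ ms) =
  if a <ᵇ m then 2 * (m ∸ a) ∷ doubledExcess a ms else doubledExcess a ms

∈-doubledBelow : ∀ {a m} S → m ∈ S → m < a → 2 * m ∈ doubledBelow a S
∈-doubledBelow {a} (x ∷ S) (here refl) m<a with x <ᵇ a | <⇒<ᵇ m<a
... | true | _ = here refl
∈-doubledBelow {a} (x ∷ S) (there m∈S) m<a with x <ᵇ a
... | true  = there (∈-doubledBelow S m∈S m<a)
... | false = ∈-doubledBelow S m∈S m<a

∈-doubledExcess : ∀ {a m} S → m ∈ S → a < m → 2 * (m ∸ a) ∈ doubledExcess a S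
∈-doubledExcess {a} (x ∷ S) (here refl) a<m with a <ᵇ x | <⇒<ᵇ a<m
... | true | _ = here refl
∈-doubledExcess {a} (x ∷ S) (there m∈S) a<m with a <ᵇ x
... | true  = there (∈-doubledExcess S m∈S a<m)
... | false = ∈-doubledExcess S m∈S a<m

advance : ℕ → List ℕ → List ℕ
advance a S = union (doubledBelow a S) (doubledExcess a S)

expand-from-advance : ∀ {a m S} → (∀ {m′} → m′ ∈ advance a S → Expansion (suc a) m′) →
                      m ∈ S → Expansion a m
expand-from-advance {a} {m} {S} expands m∈S with <-cmp m a
... | tri< m<a _ _  = expand-skip (expands (∈-union⁺ˡ _ _ (∈-doubledBelow S m∈S m<a)))
... | tri≈ _ refl _ = expand-self a
... | tri> _ _ a<m  = subst (Expansion a) (m+[n∸m]≡n (<⇒≤ a<m)) (expand-take (expands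
                        (∈-union⁺ʳ (doubledBelow a S) _ (∈-doubledExcess S m∈S a<m))))

-- n/2^n - (n+1)/2^(n+1) = start b /2^ b for b = n + 2
start : ℕ → ℕ
start b = 2 * (b ∸ 3)

withStart : ℕ → ℕ → List ℕ → List ℕ
withStart N a S = if a ≤ᵇ N then union (start a ∷ []) S else S

-- S holds the numerators m, at position a, of the expansions m/2^a still running;
-- the expansion started at b joins at position b if b ≤ N.
explore : ℕ → ℕ → ℕ → List ℕ → Bool
explore N zero    a S = null S ∧ (N <ᵇ a)
explore N (suc f) a S = explore N f (suc a) (advance a (withStart N a S))

∈-withStart-start : ∀ {N a} S → a ≤ N → start a ∈ withStart N a S
∈-withStart-start {N} {a} S a≤N with a ≤ᵇ N | ≤⇒≤ᵇ a≤N
... | true | _ = ∈-union⁺ˡ (start a ∷ []) S (here refl)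

∈-withStart-keep : ∀ {N a m} S → m ∈ S → m ∈ withStart N a S
∈-withStart-keep {N} {a} S m∈S with a ≤ᵇ N
... | true  = ∈-union⁺ʳ (start a ∷ []) S m∈S
... | false = m∈S

explore-sound : ∀ N f a S → explore N f a S ≡ true →
                (∀ {m} → m ∈ S → Expansion a m) ×
                (∀ {b} → a ≤ b → b ≤ N → Expansion b (start b))
explore-sound N zero a [] N<a = (λ ()) , λ a≤b b≤N →
  ⊥-elim (<-irrefl refl (<-≤-trans (<ᵇ⇒< N a (Equivalence.from T-≡ N<a)) (≤-trans a≤b b≤N)))
explore-sound N (suc f) a S done = expandsS , expandsStart
  where
  next : (∀ {m} → m ∈ advance a (withStart N a S) → Expansion (suc a) m) ×
         (∀ {b} → a < b → b ≤ N → Expansion b (start b))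
  next = explore-sound N f (suc a) (advance a (withStart N a S)) done

  expandsWithStart : ∀ {m} → m ∈ withStart N a S → Expansion a m
  expandsWithStart = expand-from-advance (proj₁ next)

  expandsS : ∀ {m} → m ∈ S → Expansion a m
  expandsS m∈S = expandsWithStart (∈-withStart-keep {N} {a} S m∈S)

  expandsStart : ∀ {b} → a ≤ b → b ≤ N → Expansion b (start b)
  expandsStart a≤b b≤N with m≤n⇒m<n∨m≡n a≤b
  ... | inj₁ a<b  = proj₂ next a<b b≤N
  ... | inj₂ refl = expandsWithStart (∈-withStart-start {N} S b≤N)

lookup-lowerBound : ∀ {b} L → IncreasingFrom b L →
                    (i : Fin (length L)) → b + toℕ i ≤ lookup L i
lookup-lowerBound {b} (x ∷ xs) (b≤x , inc) zero = subst (_≤ x) (sym (+-identityʳ b)) b≤x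
lookup-lowerBound {b} (x ∷ xs) (b≤x , inc) (suc i) =
  subst (_≤ lookup xs i) (sym (+-suc b (toℕ i)))
    (≤-trans (s≤s (+-monoˡ-≤ (toℕ i) b≤x)) (lookup-lowerBound xs inc i))

lookup-increasing : ∀ {b} L → IncreasingFrom b L →
                    (i j : Fin (length L)) → i <ᶠ j → lookup L i < lookup L j
lookup-increasing (x ∷ xs) (_ , inc) zero    (suc j) _         =
  ≤-trans (m≤m+n (suc x) (toℕ j)) (lookup-lowerBound xs inc j)
lookup-increasing (x ∷ xs) (_ , inc) (suc i) (suc j) (s≤s i<j) = lookup-increasing xs inc i j i<j

sumℚ-lookup : ∀ L → sumℚ (length L) (λ i → term (lookup L i)) ≡ fromℚᵘ (sumᵘ L)
sumℚ-lookup []       = refl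
sumℚ-lookup (x ∷ xs) = begin
  term x +ℚ sumℚ (length xs) (λ i → term (lookup xs i))
    ≡⟨ cong₂ _+ℚ_ (term≡fromℚᵘ x) (sumℚ-lookup xs) ⟩
  fromℚᵘ (termᵘ x) +ℚ fromℚᵘ (sumᵘ xs)
    ≡⟨ fromℚᵘ-homo-+ (termᵘ x) (sumᵘ xs) ⟨
  fromℚᵘ (termᵘ x +ᵘ sumᵘ xs)
    ∎
  where open ≡-Reasoning

termᵘ-split : ∀ m → termᵘ (suc m) ≃ termᵘ (2 + m) +ᵘ (start (3 + m) /2^ 3 + m)
termᵘ-split m = begin
  suc m /2^ suc m                    ≈⟨ /2^-double (suc m) (suc m) ⟨
  2 * suc m /2^ 2 + m                ≡⟨ cong (_/2^ 2 + m) (twice m) ⟩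
  2 + m + m /2^ 2 + m                ≈⟨ termᵘ-+-/2^ (2 + m) m ⟨
  termᵘ (2 + m) +ᵘ (2 * m /2^ 3 + m)  ∎
  where
  open ≃-Reasoning
  twice : ∀ m → 2 * suc m ≡ 2 + m + m
  twice = ℕ-Solver.solve-∀

explored : explore 10002 460600 4 [] ≡ true
explored = refl

startExpansions : ∀ {b} → 4 ≤ b → b ≤ 10002 → Expansion b (start b)
startExpansions = proj₂ (explore-sound 10002 460600 4 [] explored)

theorem3p5 : (n : ℕ) → 2 ≤ n → n ≤ 10000 →
    Σ ℕ λ k → 2 ≤ k × Σ (Fin k → ℕ) λ a →
      ((i j : Fin k) → i <ᶠ j → a i < a j) ×
      ((i : Fin k) → toℕ i ≡ 0 → a i ≡ n + 1) ×
      ((i : Fin k) → n + suc (toℕ i) ≤ a i) ×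
      (term n ≡ sumℚ k (λ i → term (a i)))
theorem3p5 n@(suc m) (s≤s 1≤m) n≤10⁴
  with expansion x xs inc sum≃ ← startExpansions {3 + m} (s≤s (s≤s (s≤s 1≤m))) (s≤s (s≤s n≤10⁴)) =
  length L , s≤s (s≤s z≤n) , lookup L , lookup-increasing L incL , first≡ , lowerBound , sum≡
  where
  L = suc n ∷ x ∷ xs

  incL : IncreasingFrom (suc n) L
  incL = ≤-refl , inc

  first≡ : (i : Fin (length L)) → toℕ i ≡ 0 → lookup L i ≡ n + 1
  first≡ zero    _  = +-comm 1 n
  first≡ (suc i) ()

  lowerBound : (i : Fin (length L)) → n + suc (toℕ i) ≤ lookup L i
  lowerBound i = subst (_≤ lookup L i) (sym (+-suc n (toℕ i))) (lookup-lowerBound L incL i)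

  sum≡ : term n ≡ sumℚ (length L) (λ i → term (lookup L i))
  sum≡ = begin
    term n                                     ≡⟨ term≡fromℚᵘ n ⟩
    fromℚᵘ (termᵘ n)                           ≡⟨ ℚ.fromℚᵘ-cong termᵘ≃sumᵘ ⟩
    fromℚᵘ (sumᵘ L)                            ≡⟨ sumℚ-lookup L ⟨
    sumℚ (length L) (λ i → term (lookup L i))  ∎
    where
    open ≡-Reasoning
    termᵘ≃sumᵘ : termᵘ n ≃ sumᵘ L
    termᵘ≃sumᵘ = ≃-trans (termᵘ-split m) (+ᵘ-congʳ (termᵘ (suc n)) (≃-sym sum≃))
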